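{- Let $G$ be a finite, simple, connected vertex-transitive graph with at least two vertices, and let $r(G)=\min\{|R_G\{x,y\}| : x,y\in V(G),\ x\neq y\}$. Then $\dim_f(G)=\frac{|V(G)|}{r(G)}$.
   Context: $G$ is vertex-transitive if its full automorphism group acts transitively on $V(G)$. For vertices $x,y$ of $G$, $R_G\{x,y\}$ is the set of vertices $z$ with $d_G(x,z)\neq d_G(y,z)$, where $d_G$ is the graph distance. A resolving function of $G$ is a function $f:V(G)\to[0,1]$ with $f(R_G\{x,y\})\geq 1$ for all distinct $x,y\in V(G)$, where $f(W)=\sum_{v\in W}f(v)$. The fractional metric dimension $\dim_f(G)$ is the minimum of $f(V(G))$ over all resolving functions $f$ of $G$.
   Formalization: Resolving functions take values in the rationals of [0,1], so $\dim_f(G)$ is a minimum of $f(V(G))$ over rational-valued resolving functions. -}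

module Defs where

open import Data.Nat using (ℕ; zero; suc; _<_; _≤_; _≡ᵇ_)
open import Data.Fin using (Fin)
open import Data.Bool using (Bool; true; false; if_then_else_)
open import Data.Product using (Σ; ∃; _×_; _,_)
open import Data.Integer using (+_)
open import Data.Rational as ℚ using (ℚ; 0ℚ; 1ℚ)
open import Relation.Binary.PropositionalEquality using (_≡_; _≢_)
open import Relation.Nullary using (¬_)
open import Function.Bundles using (_↔_; Inverse)

record Graph (n : ℕ) : Set₁ where
  field
    Adj     : Fin n → Fin n → Set
    sym     : ∀ {x y} → Adj x y → Adj y x
    irrefl  : ∀ {x} → ¬ Adj x x
open Graph public

data Walk {n : ℕ} (G : Graph n) : ℕ → Fin n → Fin n → Set where
  here : ∀ {x} → Walk G zero x x
  step : ∀ {k x y z} → Adj G x y → Walk G k y z → Walk G (suc k) x z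

Connected : ∀ {n} → Graph n → Set
Connected G = ∀ x y → ∃ λ k → Walk G k x y

IsDist : ∀ {n} → Graph n → Fin n → Fin n → ℕ → Set
IsDist G x y k = Walk G k x y × (∀ j → j < k → ¬ Walk G j x y)

IsAutomorphism : ∀ {n} → Graph n → (Fin n ↔ Fin n) → Set
IsAutomorphism G σ =
  ∀ x y → (Adj G x y → Adj G (Inverse.to σ x) (Inverse.to σ y))
        × (Adj G (Inverse.to σ x) (Inverse.to σ y) → Adj G x y)

VertexTransitive : ∀ {n} → Graph n → Set
VertexTransitive G =
  ∀ x y → Σ (_ ↔ _) λ σ → IsAutomorphism G σ × (Inverse.to σ x ≡ y)

sumℚ : ∀ {n} → (Fin n → ℚ) → ℚ
sumℚ {zero}  f = 0ℚ
sumℚ {suc n} f = f Data.Fin.zero ℚ.+ sumℚ (λ i → f (Data.Fin.suc i))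

count : ∀ {n} → (Fin n → Bool) → ℕ
count {zero}  p = 0
count {suc n} p = (if p Data.Fin.zero then 1 else 0) Data.Nat.+ count (λ i → p (Data.Fin.suc i))

inR : ∀ {n} → (Fin n → Fin n → ℕ) → Fin n → Fin n → Fin n → Bool
inR d x y z = if d x z ≡ᵇ d y z then false else true

sizeR : ∀ {n} → (Fin n → Fin n → ℕ) → Fin n → Fin n → ℕ
sizeR d x y = count (inR d x y)

weightR : ∀ {n} → (Fin n → Fin n → ℕ) → (Fin n → ℚ) → Fin n → Fin n → ℚ
weightR d f x y = sumℚ (λ z → if inR d x y z then f z else 0ℚ)

IsMinR : ∀ {n} → (Fin n → Fin n → ℕ) → ℕ → Set
IsMinR d r = (∃ λ x → ∃ λ y → x ≢ y × sizeR d x y ≡ r)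
           × (∀ x y → x ≢ y → r ≤ sizeR d x y)

IsResolving : ∀ {n} → (Fin n → Fin n → ℕ) → (Fin n → ℚ) → Set
IsResolving d f = (∀ v → (0ℚ ℚ.≤ f v) × (f v ℚ.≤ 1ℚ))
                × (∀ x y → x ≢ y → 1ℚ ℚ.≤ weightR d f x y)

IsFracMetricDim : ∀ {n} → (Fin n → Fin n → ℕ) → ℚ → Set
IsFracMetricDim d m = (∃ λ f → IsResolving d f × sumℚ f ≡ m)
                    × (∀ f → IsResolving d f → m ℚ.≤ sumℚ f)

ℕtoℚ : ℕ → ℚ
ℕtoℚ k = + k ℚ./ 1

{-# OPTIONS --safe #-}
module Submission where

-- Call an ordered pair (u,v) critical when |R{u,v}| = r, and let c(z) be the number of critical pairs
-- resolved by z. Distance-preserving permutations permute the critical pairs, so by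
-- transitivity c is constant, and counting the incidences (z, (u,v)) both ways gives
-- n·c = r·#critical. For a resolving f, summing f(R{u,v}) ≥ 1 over the critical pairs gives
-- #critical ≤ f(V)·c, hence f(V) ≥ n/r; the constant function 1/r attains this bound
-- because every |R{x,y}| is at least r.

open import Defs hiding (sym)
open import Data.Nat using (ℕ; _≥_)
open import Data.Fin using (Fin)
open import Data.Product using (_×_; ∃)
open import Relation.Binary.PropositionalEquality using (_≡_)
open import Data.Rational using (ℚ; _*_)

open import Algebra.Bundles using (CommutativeMonoid; CommutativeRing)
import Algebra.Properties.CommutativeMonoid.Sum as CommutativeMonoidSum
import Algebra.Properties.CommutativeSemigroup as CommutativeSemigroupProperties
import Algebra.Properties.Semiring.Sum as SemiringSum
open import Data.Bool using (Bool; true; false; if_then_else_)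
import Data.Bool.Properties as BoolP
open import Data.Empty using (⊥-elim)
open import Data.Fin using (zero; suc)
open import Data.Integer as ℤ using (+≤+)
import Data.Integer.Properties as ℤP
open import Data.Nat as ℕ using (suc; _≡ᵇ_; z≤n; s≤s)
import Data.Nat.Coprimality as Coprimality
import Data.Nat.Properties as ℕP
open import Data.Product using (Σ; _,_; proj₁; proj₂)
open import Data.Rational as ℚ using (0ℚ; 1ℚ; mkℚ; 1/_; _÷_; _+_; _≤_; Positive; NonNegative)
import Data.Rational.Properties as ℚP
open import Function.Base using (_∘_)
open import Function.Bundles using (_↔_; Inverse; Equivalence)
open import Relation.Binary.PropositionalEquality
  using (_≢_; refl; sym; trans; cong; cong₂; subst; subst₂; module ≡-Reasoning)

ℕtoℚ≡mkℚ : ∀ k → ℕtoℚ k ≡ mkℚ (ℤ.+ k) 0 (Coprimality.sym (Coprimality.1-coprimeTo k))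
ℕtoℚ≡mkℚ k = ℚP.normalize-coprime (Coprimality.sym (Coprimality.1-coprimeTo k))

ℕtoℚ-suc : ∀ k → ℕtoℚ (suc k) ≡ 1ℚ + ℕtoℚ k
ℕtoℚ-suc k = trans (ℚP./-cong {p₂ = ℤ.+ 1 ℤ.* ℤ.+ 1 ℤ.+ ℤ.+ k ℤ.* ℤ.+ 1} numerators refl)
                   (cong (1ℚ +_) (sym (ℕtoℚ≡mkℚ k)))
  where
  numerators : ℤ.+ suc k ≡ ℤ.+ 1 ℤ.* ℤ.+ 1 ℤ.+ ℤ.+ k ℤ.* ℤ.+ 1
  numerators = cong (λ t → ℤ.+ 1 ℤ.+ t) (sym (ℤP.*-identityʳ (ℤ.+ k)))

ℕtoℚ-mono-≤ : ∀ {a b} → a ℕ.≤ b → ℕtoℚ a ≤ ℕtoℚ b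
ℕtoℚ-mono-≤ {a} {b} a≤b = subst₂ _≤_ (sym (ℕtoℚ≡mkℚ a)) (sym (ℕtoℚ≡mkℚ b)) (ℚ.*≤* cross)
  where
  cross : ℤ.+ a ℤ.* ℤ.+ 1 ℤ.≤ ℤ.+ b ℤ.* ℤ.+ 1
  cross rewrite ℤP.*-identityʳ (ℤ.+ a) | ℤP.*-identityʳ (ℤ.+ b) = +≤+ a≤b

ℕtoℚ-pos : ∀ k .{{_ : ℕ.NonZero k}} → Positive (ℕtoℚ k)
ℕtoℚ-pos (suc k) = subst Positive (sym (ℕtoℚ≡mkℚ (suc k))) _

ℕtoℚ-nonNeg : ∀ k → NonNegative (ℕtoℚ k)
ℕtoℚ-nonNeg k = subst NonNegative (sym (ℕtoℚ≡mkℚ k)) _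

ℕtoℚ-nonZero : ∀ k .{{_ : ℕ.NonZero k}} → ℚ.NonZero (ℕtoℚ k)
ℕtoℚ-nonZero k = ℚP.pos⇒nonZero (ℕtoℚ k) {{ℕtoℚ-pos k}}

module _ (r : ℕ) .{{_ : ℕ.NonZero r}} where
  private
    instance
      r-nonZero : ℚ.NonZero (ℕtoℚ r)
      r-nonZero = ℕtoℚ-nonZero r

      1/r-nonNeg : NonNegative (1/ ℕtoℚ r)
      1/r-nonNeg = ℚP.pos⇒nonNeg (1/ ℕtoℚ r) {{ℚP.1/pos⇒pos (ℕtoℚ r) {{ℕtoℚ-pos r}}}}

  1≤1/r*s : ∀ {s} → r ℕ.≤ s → 1ℚ ≤ 1/ ℕtoℚ r * ℕtoℚ s
  1≤1/r*s {s} r≤s =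
    subst (_≤ 1/ ℕtoℚ r * ℕtoℚ s) (ℚP.*-inverseˡ (ℕtoℚ r))
          (ℚP.*-monoˡ-≤-nonNeg (1/ ℕtoℚ r) (ℕtoℚ-mono-≤ r≤s))

  0≤1/r≤1 : 0ℚ ≤ 1/ ℕtoℚ r × 1/ ℕtoℚ r ≤ 1ℚ
  0≤1/r≤1 = ℚP.nonNegative⁻¹ (1/ ℕtoℚ r) ,
            subst₂ _≤_ (ℚP.*-identityʳ (1/ ℕtoℚ r)) (ℚP.*-inverseˡ (ℕtoℚ r))
                   (ℚP.*-monoˡ-≤-nonNeg (1/ ℕtoℚ r) (ℕtoℚ-mono-≤ {1} (ℕ.>-nonZero⁻¹ r)))

  ÷r*r : ∀ p → p ÷ ℕtoℚ r * ℕtoℚ r ≡ p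
  ÷r*r p = begin
    p * 1/ ℕtoℚ r * ℕtoℚ r    ≡⟨ ℚP.*-assoc p (1/ ℕtoℚ r) (ℕtoℚ r) ⟩
    p * (1/ ℕtoℚ r * ℕtoℚ r)  ≡⟨ cong (p *_) (ℚP.*-inverseˡ (ℕtoℚ r)) ⟩
    p * 1ℚ                    ≡⟨ ℚP.*-identityʳ p ⟩
    p                         ∎
    where open ≡-Reasoning

  ≤*r⇒÷r≤ : ∀ {p q} → p ≤ q * ℕtoℚ r → p ÷ ℕtoℚ r ≤ q
  ≤*r⇒÷r≤ {p} {q} p≤qr = begin
    p * 1/ ℕtoℚ r               ≤⟨ ℚP.*-monoʳ-≤-nonNeg (1/ ℕtoℚ r) p≤qr ⟩
    q * ℕtoℚ r * 1/ ℕtoℚ r      ≡⟨ ℚP.*-assoc q (ℕtoℚ r) (1/ ℕtoℚ r) ⟩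
    q * (ℕtoℚ r * 1/ ℕtoℚ r)    ≡⟨ cong (q *_) (ℚP.*-inverseʳ (ℕtoℚ r)) ⟩
    q * 1ℚ                      ≡⟨ ℚP.*-identityʳ q ⟩
    q                           ∎
    where open ℚP.≤-Reasoning

module ΣℚP = SemiringSum (CommutativeRing.semiring ℚP.+-*-commutativeRing)
module ΣℕP = CommutativeMonoidSum ℕP.+-0-commutativeMonoid
open CommutativeSemigroupProperties (CommutativeMonoid.commutativeSemigroup ℚP.*-1-commutativeMonoid)
  using (x∙yz≈y∙xz)

sumℚ≡sum : ∀ {n} (f : Fin n → ℚ) → sumℚ f ≡ ΣℚP.sum f
sumℚ≡sum {ℕ.zero} f = refl
sumℚ≡sum {suc n}  f = cong (f zero +_) (sumℚ≡sum (f ∘ suc))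

sumℚ-cong : ∀ {n} {f g : Fin n → ℚ} → (∀ i → f i ≡ g i) → sumℚ f ≡ sumℚ g
sumℚ-cong {f = f} {g} f≗g =
  trans (sumℚ≡sum f) (trans (ΣℚP.sum-cong-≗ f≗g) (sym (sumℚ≡sum g)))

*-distribˡ-sumℚ : ∀ {n} c (f : Fin n → ℚ) → c * sumℚ f ≡ sumℚ (λ i → c * f i)
*-distribˡ-sumℚ c f = begin
  c * sumℚ f                ≡⟨ cong (c *_) (sumℚ≡sum f) ⟩
  c * ΣℚP.sum f             ≡⟨ ΣℚP.*-distribˡ-sum c f ⟩
  ΣℚP.sum (λ i → c * f i)   ≡⟨ sumℚ≡sum (λ i → c * f i) ⟨
  sumℚ (λ i → c * f i)      ∎
  where open ≡-Reasoning

*-distribʳ-sumℚ : ∀ {n} c (f : Fin n → ℚ) → sumℚ f * c ≡ sumℚ (λ i → f i * c)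
*-distribʳ-sumℚ c f =
  trans (ℚP.*-comm (sumℚ f) c) (trans (*-distribˡ-sumℚ c f) (sumℚ-cong (λ i → ℚP.*-comm c (f i))))

sumℚ-comm : ∀ {m n} (f : Fin m → Fin n → ℚ) →
            sumℚ (λ i → sumℚ (f i)) ≡ sumℚ (λ j → sumℚ (λ i → f i j))
sumℚ-comm f = begin
  sumℚ (λ i → sumℚ (f i))                   ≡⟨ sumℚ-cong (λ i → sumℚ≡sum (f i)) ⟩
  sumℚ (λ i → ΣℚP.sum (f i))                ≡⟨ sumℚ≡sum (λ i → ΣℚP.sum (f i)) ⟩
  ΣℚP.sum (λ i → ΣℚP.sum (f i))             ≡⟨ ΣℚP.∑-comm f ⟩
  ΣℚP.sum (λ j → ΣℚP.sum (λ i → f i j))     ≡⟨ sumℚ≡sum (λ j → ΣℚP.sum (λ i → f i j)) ⟨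
  sumℚ (λ j → ΣℚP.sum (λ i → f i j))        ≡⟨ sumℚ-cong (λ j → sumℚ≡sum (λ i → f i j)) ⟨
  sumℚ (λ j → sumℚ (λ i → f i j))           ∎
  where open ≡-Reasoning

sumℚ-permute : ∀ {n} (f : Fin n → ℚ) (σ : Fin n ↔ Fin n) → sumℚ f ≡ sumℚ (f ∘ Inverse.to σ)
sumℚ-permute f σ =
  trans (sumℚ≡sum f) (trans (ΣℚP.sum-permute f σ) (sym (sumℚ≡sum (f ∘ Inverse.to σ))))

sumℚ-const : ∀ n c → sumℚ {n} (λ _ → c) ≡ ℕtoℚ n * c
sumℚ-const ℕ.zero  c = sym (ℚP.*-zeroˡ c)
sumℚ-const (suc n) c = begin
  c + sumℚ {n} (λ _ → c)   ≡⟨ cong₂ _+_ (sym (ℚP.*-identityˡ c)) (sumℚ-const n c) ⟩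
  1ℚ * c + ℕtoℚ n * c      ≡⟨ ℚP.*-distribʳ-+ c 1ℚ (ℕtoℚ n) ⟨
  (1ℚ + ℕtoℚ n) * c        ≡⟨ cong (_* c) (ℕtoℚ-suc n) ⟨
  ℕtoℚ (suc n) * c         ∎
  where open ≡-Reasoning

sumℚ-mono-≤ : ∀ {n} {f g : Fin n → ℚ} → (∀ i → f i ≤ g i) → sumℚ f ≤ sumℚ g
sumℚ-mono-≤ {ℕ.zero} f≤g = ℚP.≤-refl
sumℚ-mono-≤ {suc n}  f≤g = ℚP.+-mono-≤ (f≤g zero) (sumℚ-mono-≤ (f≤g ∘ suc))

sumℚ-nonNeg : ∀ {n} {f : Fin n → ℚ} → (∀ i → 0ℚ ≤ f i) → 0ℚ ≤ sumℚ f
sumℚ-nonNeg {n} {f} 0≤f =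
  subst (_≤ sumℚ f) (trans (sumℚ-const n 0ℚ) (ℚP.*-zeroʳ (ℕtoℚ n))) (sumℚ-mono-≤ 0≤f)

term≤sumℚ : ∀ {n} {f : Fin n → ℚ} → (∀ i → 0ℚ ≤ f i) → ∀ k → f k ≤ sumℚ f
term≤sumℚ {f = f} 0≤f zero =
  subst (_≤ sumℚ f) (ℚP.+-identityʳ (f zero)) (ℚP.+-monoʳ-≤ (f zero) (sumℚ-nonNeg (0≤f ∘ suc)))
term≤sumℚ {f = f} 0≤f (suc k) =
  ℚP.≤-trans (term≤sumℚ (0≤f ∘ suc) k)
             (subst (_≤ sumℚ f) (ℚP.+-identityˡ _) (ℚP.+-monoˡ-≤ _ (0≤f zero)))

sumℚ-weighted-comm : ∀ {k m n} (a : Fin k → Fin m → ℚ) (f : Fin n → ℚ) (c : Fin k → Fin m → Fin n → ℚ) →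
  sumℚ (λ u → sumℚ (λ v → a u v * sumℚ (λ z → f z * c u v z))) ≡
  sumℚ (λ z → f z * sumℚ (λ u → sumℚ (λ v → a u v * c u v z)))
sumℚ-weighted-comm a f c = begin
  sumℚ (λ u → sumℚ (λ v → a u v * sumℚ (λ z → f z * c u v z)))
    ≡⟨ sumℚ-cong (λ u → sumℚ-cong (λ v → trans (*-distribˡ-sumℚ (a u v) (λ z → f z * c u v z))
                                          (sumℚ-cong (λ z → x∙yz≈y∙xz (a u v) (f z) (c u v z))))) ⟩
  sumℚ (λ u → sumℚ (λ v → sumℚ (λ z → f z * (a u v * c u v z))))
    ≡⟨ sumℚ-cong (λ u → sumℚ-comm (λ v z → f z * (a u v * c u v z))) ⟩
  sumℚ (λ u → sumℚ (λ z → sumℚ (λ v → f z * (a u v * c u v z))))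
    ≡⟨ sumℚ-comm (λ u z → sumℚ (λ v → f z * (a u v * c u v z))) ⟩
  sumℚ (λ z → sumℚ (λ u → sumℚ (λ v → f z * (a u v * c u v z))))
    ≡⟨ sumℚ-cong (λ z → trans (sumℚ-cong (λ u → sym (*-distribˡ-sumℚ (f z) (λ v → a u v * c u v z))))
                              (sym (*-distribˡ-sumℚ (f z) (λ u → sumℚ (λ v → a u v * c u v z))))) ⟩
  sumℚ (λ z → f z * sumℚ (λ u → sumℚ (λ v → a u v * c u v z))) ∎
  where open ≡-Reasoning

indicator : Bool → ℚ
indicator b = if b then 1ℚ else 0ℚ

indicator-nonNeg : ∀ b → 0ℚ ≤ indicator b
indicator-nonNeg true  = ℚP.nonNegative⁻¹ 1ℚ
indicator-nonNeg false = ℚP.≤-refl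

if-then-0≡*-indicator : ∀ b p → (if b then p else 0ℚ) ≡ p * indicator b
if-then-0≡*-indicator true  p = sym (ℚP.*-identityʳ p)
if-then-0≡*-indicator false p = sym (ℚP.*-zeroʳ p)

indicator-*-cong : ∀ b {p q} → (b ≡ true → p ≡ q) → indicator b * p ≡ indicator b * q
indicator-*-cong true  p≡q = cong (1ℚ *_) (p≡q refl)
indicator-*-cong false {p} {q} p≡q = trans (ℚP.*-zeroˡ p) (sym (ℚP.*-zeroˡ q))

indicator≤indicator-* : ∀ b {p} → (b ≡ true → 1ℚ ≤ p) → indicator b ≤ indicator b * p
indicator≤indicator-* true  1≤p = subst (1ℚ ≤_) (sym (ℚP.*-identityˡ _)) (1≤p refl)
indicator≤indicator-* false {p} 1≤p = ℚP.≤-reflexive (sym (ℚP.*-zeroˡ p))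

ℕtoℚ-count : ∀ {n} (p : Fin n → Bool) → ℕtoℚ (count p) ≡ sumℚ (indicator ∘ p)
ℕtoℚ-count {ℕ.zero} p = refl
ℕtoℚ-count {suc n}  p with p zero
... | true  = trans (ℕtoℚ-suc (count (p ∘ suc))) (cong (1ℚ +_) (ℕtoℚ-count (p ∘ suc)))
... | false = trans (ℕtoℚ-count (p ∘ suc)) (sym (ℚP.+-identityˡ (sumℚ (indicator ∘ p ∘ suc))))

count≡sum : ∀ {n} (p : Fin n → Bool) → count p ≡ ΣℕP.sum (λ i → if p i then 1 else 0)
count≡sum {ℕ.zero} p = refl
count≡sum {suc n}  p = cong ((if p zero then 1 else 0) ℕ.+_) (count≡sum (p ∘ suc))

count-cong : ∀ {n} {p q : Fin n → Bool} → (∀ i → p i ≡ q i) → count p ≡ count q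
count-cong {p = p} {q} p≗q =
  trans (count≡sum p) (trans (ΣℕP.sum-cong-≗ (λ i → cong (if_then 1 else 0) (p≗q i))) (sym (count≡sum q)))

count-permute : ∀ {n} (p : Fin n → Bool) (σ : Fin n ↔ Fin n) → count p ≡ count (p ∘ Inverse.to σ)
count-permute p σ =
  trans (count≡sum p) (trans (ΣℕP.sum-permute _ σ) (sym (count≡sum (p ∘ Inverse.to σ))))

count-pos : ∀ {n} {p : Fin n → Bool} i → p i ≡ true → 1 ℕ.≤ count p
count-pos zero    pi≡true rewrite pi≡true = s≤s z≤n
count-pos (suc i) pi≡true = ℕP.≤-trans (count-pos i pi≡true) (ℕP.m≤n+m _ _)

count-false : ∀ {n} {p : Fin n → Bool} → (∀ i → p i ≡ false) → count p ≡ 0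
count-false {ℕ.zero} p≗false = refl
count-false {suc n}  p≗false rewrite p≗false zero = count-false (p≗false ∘ suc)

≡ᵇ-true⇒≡ : ∀ {a b} → (a ≡ᵇ b) ≡ true → a ≡ b
≡ᵇ-true⇒≡ {a} {b} eq = ℕP.≡ᵇ⇒≡ a b (Equivalence.from BoolP.T-≡ eq)

≡⇒≡ᵇ-true : ∀ {a b} → a ≡ b → (a ≡ᵇ b) ≡ true
≡⇒≡ᵇ-true {a} {b} eq = Equivalence.to BoolP.T-≡ (ℕP.≡⇒≡ᵇ a b eq)

-- Resolving functions for a distance function with transitive symmetries

module _ {n : ℕ} (d : Fin n → Fin n → ℕ) where

  IsSymmetry : Fin n ↔ Fin n → Set
  IsSymmetry σ = ∀ a b → d (Inverse.to σ a) (Inverse.to σ b) ≡ d a b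

  SymmetriesTransitive : Set
  SymmetriesTransitive = ∀ x y → Σ (Fin n ↔ Fin n) λ σ → IsSymmetry σ × Inverse.to σ x ≡ y

  module _ {σ : Fin n ↔ Fin n} (σ-sym : IsSymmetry σ) where
    private
      τ : Fin n → Fin n
      τ = Inverse.to σ

    inR-symmetry : ∀ u v z → inR d (τ u) (τ v) (τ z) ≡ inR d u v z
    inR-symmetry u v z = cong₂ (λ a b → if a ≡ᵇ b then false else true) (σ-sym u z) (σ-sym v z)

    sizeR-symmetry : ∀ u v → sizeR d (τ u) (τ v) ≡ sizeR d u v
    sizeR-symmetry u v = trans (count-permute (inR d (τ u) (τ v)) σ) (count-cong (inR-symmetry u v))

  sizeR-diag : ∀ u → sizeR d u u ≡ 0
  sizeR-diag u = count-false (λ z → cong (if_then false else true) (≡⇒≡ᵇ-true {d u z} refl))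

  inR-≢ : ∀ {x y z} → d x z ≢ d y z → inR d x y z ≡ true
  inR-≢ {x} {y} {z} dxz≢dyz with d x z ≡ᵇ d y z in eq
  ... | true  = ⊥-elim (dxz≢dyz (≡ᵇ-true⇒≡ eq))
  ... | false = refl

  weightR≡sumℚ : ∀ f u v → weightR d f u v ≡ sumℚ (λ z → f z * indicator (inR d u v z))
  weightR≡sumℚ f u v = sumℚ-cong (λ z → if-then-0≡*-indicator (inR d u v z) (f z))

  weightR-const : ∀ c u v → weightR d (λ _ → c) u v ≡ c * ℕtoℚ (sizeR d u v)
  weightR-const c u v = begin
    weightR d (λ _ → c) u v                       ≡⟨ weightR≡sumℚ (λ _ → c) u v ⟩
    sumℚ (λ z → c * indicator (inR d u v z))      ≡⟨ *-distribˡ-sumℚ c (indicator ∘ inR d u v) ⟨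
    c * sumℚ (indicator ∘ inR d u v)              ≡⟨ cong (c *_) (ℕtoℚ-count (inR d u v)) ⟨
    c * ℕtoℚ (sizeR d u v)                        ∎
    where open ≡-Reasoning

  module _ (r : ℕ) .{{_ : ℕ.NonZero r}} where
    private
      instance
        r-nonZero : ℚ.NonZero (ℕtoℚ r)
        r-nonZero = ℕtoℚ-nonZero r

    const-resolving : (∀ x y → x ≢ y → r ℕ.≤ sizeR d x y) → IsResolving d (λ _ → 1/ ℕtoℚ r)
    const-resolving r≤sizeR = (λ _ → 0≤1/r≤1 r) , λ x y x≢y →
      subst (1ℚ ≤_) (sym (weightR-const (1/ ℕtoℚ r) x y)) (1≤1/r*s r (r≤sizeR x y x≢y))

    module DoubleCounting (transitive : SymmetriesTransitive) where

      critical : Fin n → Fin n → ℚ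
      critical u v = indicator (sizeR d u v ≡ᵇ r)

      #critical : ℚ
      #critical = sumℚ (λ u → sumℚ (critical u))

      coverage : Fin n → ℚ
      coverage z = sumℚ (λ u → sumℚ (λ v → critical u v * indicator (inR d u v z)))

      coverage-symmetry : ∀ {σ} → IsSymmetry σ → ∀ z → coverage (Inverse.to σ z) ≡ coverage z
      coverage-symmetry {σ} σ-sym z = begin
        sumℚ (λ u → sumℚ (λ v → critical u v * indicator (inR d u v (τ z))))
          ≡⟨ sumℚ-permute (λ u → sumℚ (λ v → critical u v * indicator (inR d u v (τ z)))) σ ⟩
        sumℚ (λ u → sumℚ (λ v → critical (τ u) v * indicator (inR d (τ u) v (τ z))))
          ≡⟨ sumℚ-cong (λ u → sumℚ-permute (λ v → critical (τ u) v * indicator (inR d (τ u) v (τ z))) σ) ⟩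
        sumℚ (λ u → sumℚ (λ v → critical (τ u) (τ v) * indicator (inR d (τ u) (τ v) (τ z))))
          ≡⟨ sumℚ-cong (λ u → sumℚ-cong (λ v →
               cong₂ (λ s b → indicator (s ≡ᵇ r) * indicator b)
                     (sizeR-symmetry {σ = σ} σ-sym u v) (inR-symmetry {σ = σ} σ-sym u v z))) ⟩
        coverage z ∎
        where
        open ≡-Reasoning
        τ : Fin n → Fin n
        τ = Inverse.to σ

      coverage-constant : ∀ y z → coverage y ≡ coverage z
      coverage-constant y z with transitive z y
      ... | σ , σ-sym , σz≡y = trans (cong coverage (sym σz≡y)) (coverage-symmetry {σ} σ-sym z)

      double-count : ∀ f → sumℚ (λ u → sumℚ (λ v → critical u v * weightR d f u v)) ≡
                           sumℚ (λ z → f z * coverage z)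
      double-count f =
        trans (sumℚ-cong (λ u → sumℚ-cong (λ v → cong (critical u v *_) (weightR≡sumℚ f u v))))
              (sumℚ-weighted-comm critical f (λ u v → indicator ∘ inR d u v))

      critical-sizeR : ∀ u v → critical u v * ℕtoℚ (sizeR d u v) ≡ critical u v * ℕtoℚ r
      critical-sizeR u v = indicator-*-cong (sizeR d u v ≡ᵇ r) (cong ℕtoℚ ∘ ≡ᵇ-true⇒≡ {sizeR d u v})

      critical⇒≢ : ∀ {u v} → (sizeR d u v ≡ᵇ r) ≡ true → u ≢ v
      critical⇒≢ {u} critical-uv refl =
        ℕ.≢-nonZero⁻¹ r (trans (sym (≡ᵇ-true⇒≡ critical-uv)) (sizeR-diag u))

      coverage-total : ∀ z → ℕtoℚ n * coverage z ≡ ℕtoℚ r * #critical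
      coverage-total z = begin
        ℕtoℚ n * coverage z
          ≡⟨ sumℚ-const n (coverage z) ⟨
        sumℚ {n} (λ _ → coverage z)
          ≡⟨ sumℚ-cong (λ y → trans (coverage-constant z y) (sym (ℚP.*-identityˡ (coverage y)))) ⟩
        sumℚ (λ y → 1ℚ * coverage y)
          ≡⟨ double-count (λ _ → 1ℚ) ⟨
        sumℚ (λ u → sumℚ (λ v → critical u v * weightR d (λ _ → 1ℚ) u v))
          ≡⟨ sumℚ-cong (λ u → sumℚ-cong (λ v → begin
               critical u v * weightR d (λ _ → 1ℚ) u v   ≡⟨ cong (critical u v *_) (weightR-const 1ℚ u v) ⟩
               critical u v * (1ℚ * ℕtoℚ (sizeR d u v))
                 ≡⟨ cong (critical u v *_) (ℚP.*-identityˡ (ℕtoℚ (sizeR d u v))) ⟩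
               critical u v * ℕtoℚ (sizeR d u v)         ≡⟨ critical-sizeR u v ⟩
               critical u v * ℕtoℚ r                     ≡⟨ ℚP.*-comm (critical u v) (ℕtoℚ r) ⟩
               ℕtoℚ r * critical u v                     ∎)) ⟩
        sumℚ (λ u → sumℚ (λ v → ℕtoℚ r * critical u v))
          ≡⟨ trans (sumℚ-cong (λ u → sym (*-distribˡ-sumℚ (ℕtoℚ r) (critical u))))
                   (sym (*-distribˡ-sumℚ (ℕtoℚ r) (λ u → sumℚ (critical u)))) ⟩
        ℕtoℚ r * #critical ∎
        where open ≡-Reasoning

      #critical-pos : ∀ {x y} → sizeR d x y ≡ r → Positive #critical
      #critical-pos {x} {y} sizeR≡r = ℚ.positive (ℚP.<-≤-trans (ℚP.positive⁻¹ 1ℚ) 1≤#critical)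
        where
        1≤#critical : 1ℚ ≤ #critical
        1≤#critical = subst (_≤ #critical) (cong indicator (≡⇒≡ᵇ-true sizeR≡r))
          (ℚP.≤-trans (term≤sumℚ (λ v → indicator-nonNeg (sizeR d x v ≡ᵇ r)) y)
                      (term≤sumℚ (λ u → sumℚ-nonNeg (λ v → indicator-nonNeg (sizeR d u v ≡ᵇ r))) x))

      #critical≤ : ∀ {f} → IsResolving d f → ∀ z → #critical ≤ sumℚ f * coverage z
      #critical≤ {f} f-resolving z = begin
        #critical
          ≤⟨ sumℚ-mono-≤ (λ u → sumℚ-mono-≤ (λ v → indicator≤indicator-* (sizeR d u v ≡ᵇ r)
               (λ critical-uv → proj₂ f-resolving u v (critical⇒≢ critical-uv)))) ⟩
        sumℚ (λ u → sumℚ (λ v → critical u v * weightR d f u v))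
          ≡⟨ double-count f ⟩
        sumℚ (λ y → f y * coverage y)
          ≡⟨ sumℚ-cong (λ y → cong (f y *_) (coverage-constant y z)) ⟩
        sumℚ (λ y → f y * coverage z)
          ≡⟨ *-distribʳ-sumℚ (coverage z) f ⟨
        sumℚ f * coverage z ∎
        where open ℚP.≤-Reasoning

      lower-bound : ∀ {x y} → sizeR d x y ≡ r → ∀ {f} → IsResolving d f → ℕtoℚ n ≤ sumℚ f * ℕtoℚ r
      lower-bound {x} sizeR≡r {f} f-resolving =
        ℚP.*-cancelʳ-≤-pos #critical {{#critical-pos sizeR≡r}} (begin
          ℕtoℚ n * #critical
            ≤⟨ ℚP.*-monoˡ-≤-nonNeg (ℕtoℚ n) {{ℕtoℚ-nonNeg n}} (#critical≤ f-resolving x) ⟩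
          ℕtoℚ n * (sumℚ f * coverage x)
            ≡⟨ x∙yz≈y∙xz (ℕtoℚ n) (sumℚ f) (coverage x) ⟩
          sumℚ f * (ℕtoℚ n * coverage x)
            ≡⟨ cong (sumℚ f *_) (coverage-total x) ⟩
          sumℚ f * (ℕtoℚ r * #critical)
            ≡⟨ ℚP.*-assoc (sumℚ f) (ℕtoℚ r) #critical ⟨
          sumℚ f * ℕtoℚ r * #critical ∎)
        where open ℚP.≤-Reasoning

    fracMetricDim-transitive : SymmetriesTransitive → IsMinR d r → IsFracMetricDim d (ℕtoℚ n ÷ ℕtoℚ r)
    fracMetricDim-transitive transitive ((_ , _ , _ , sizeR≡r) , r≤sizeR) =
      ((λ _ → 1/ ℕtoℚ r) , const-resolving r≤sizeR , sumℚ-const n (1/ ℕtoℚ r)) ,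
      λ f f-resolving → ≤*r⇒÷r≤ r (lower-bound sizeR≡r f-resolving)
      where open DoubleCounting transitive

-- Distances in graphs

module _ {n : ℕ} (G : Graph n) where

  Walk-map : ∀ {f : Fin n → Fin n} → (∀ {a b} → Adj G a b → Adj G (f a) (f b)) →
             ∀ {k a b} → Walk G k a b → Walk G k (f a) (f b)
  Walk-map f-adj here         = here
  Walk-map f-adj (step adj w) = step (f-adj adj) (Walk-map f-adj w)

  IsDist-unique : ∀ {x y k l} → IsDist G x y k → IsDist G x y l → k ≡ l
  IsDist-unique (wk , k-min) (wl , l-min) =
    ℕP.≤-antisym (ℕP.≮⇒≥ (λ l<k → k-min _ l<k wl)) (ℕP.≮⇒≥ (λ k<l → l-min _ k<l wk))

  IsDist-refl : ∀ x → IsDist G x x 0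
  IsDist-refl x = here , λ _ ()

  module _ {σ : Fin n ↔ Fin n} (σ-aut : IsAutomorphism G σ) where
    private
      to from : Fin n → Fin n
      to = Inverse.to σ
      from = Inverse.from σ

    Walk-reflect : ∀ {k a b} → Walk G k (to a) (to b) → Walk G k a b
    Walk-reflect {k} {a} {b} w =
      subst₂ (Walk G k) (Inverse.inverseʳ σ refl) (Inverse.inverseʳ σ refl) (Walk-map from-adj w)
      where
      from-adj : ∀ {a′ b′} → Adj G a′ b′ → Adj G (from a′) (from b′)
      from-adj {a′} {b′} adj = proj₂ (σ-aut (from a′) (from b′))
        (subst₂ (Adj G) (sym (Inverse.inverseˡ σ refl)) (sym (Inverse.inverseˡ σ refl)) adj)

    IsDist-automorphism : ∀ {a b k} → IsDist G a b k → IsDist G (to a) (to b) k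
    IsDist-automorphism (w , k-min) =
      Walk-map (proj₁ (σ-aut _ _)) w , λ j j<k w′ → k-min j j<k (Walk-reflect w′)

  Walk-zero : ∀ {a b} → Walk G 0 a b → a ≡ b
  Walk-zero here = refl

  module _ {d : Fin n → Fin n → ℕ} (d-dist : ∀ x y → IsDist G x y (d x y)) where

    automorphism⇒symmetry : ∀ {σ} → IsAutomorphism G σ → IsSymmetry d σ
    automorphism⇒symmetry {σ} σ-aut a b =
      IsDist-unique (d-dist _ _) (IsDist-automorphism {σ = σ} σ-aut (d-dist a b))

    vertexTransitive⇒symmetriesTransitive : VertexTransitive G → SymmetriesTransitive d
    vertexTransitive⇒symmetriesTransitive vt x y with vt x y
    ... | σ , σ-aut , σx≡y = σ , automorphism⇒symmetry {σ} σ-aut , σx≡y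

    ≢⇒1≤sizeR : ∀ {x y} → x ≢ y → 1 ℕ.≤ sizeR d x y
    ≢⇒1≤sizeR {x} {y} x≢y = count-pos x (inR-≢ d dxx≢dyx)
      where
      dxx≢dyx : d x x ≢ d y x
      dxx≢dyx dxx≡dyx = x≢y (sym (Walk-zero (subst (λ k → Walk G k y x) dyx≡0 (proj₁ (d-dist y x)))))
        where
        dyx≡0 : d y x ≡ 0
        dyx≡0 = trans (sym dxx≡dyx) (IsDist-unique (d-dist x x) (IsDist-refl x))

theorem2p2 : (n : ℕ) → n ≥ 2 → (G : Graph n) → Connected G → VertexTransitive G →
    (d : Fin n → Fin n → ℕ) → (∀ x y → IsDist G x y (d x y)) →
    (r : ℕ) → IsMinR d r →
    ∃ λ (m : ℚ) → IsFracMetricDim d m × (m * ℕtoℚ r ≡ ℕtoℚ n)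
theorem2p2 n _ G _ vt d d-dist r r-min@((x , y , x≢y , sizeR≡r) , _) =
  _ , fracMetricDim-transitive d r (vertexTransitive⇒symmetriesTransitive G d-dist vt) r-min ,
  ÷r*r r (ℕtoℚ n)
  where
  instance
    r-nonZero : ℕ.NonZero r
    r-nonZero = ℕ.>-nonZero (subst (1 ℕ.≤_) sizeR≡r (≢⇒1≤sizeR G d-dist x≢y))
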